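{- Let $d\ge 2$ be an integer and $n=(3d+1)m$ with $m$ a positive integer. Then $\chi_d(C_n(2,3))=3d+1$.
   Context: For integers $n$ and $s_1,\ldots,s_k$, the circulant graph $C_n(s_1,\ldots,s_k)$ has vertex set $\{0,1,\ldots,n-1\}$, and each vertex $i$ is adjacent to $i+s_j \pmod n$ (and hence to $i-s_j\pmod n$) for every $j$. For a graph $G$ and a positive integer $d$, a $d$-distance $k$-coloring is a map $f:V(G)\to\{1,\ldots,k\}$ such that any two distinct vertices $u,v$ with $f(u)=f(v)$ satisfy $d_G(u,v)>d$ ($d_G$ the shortest-path distance); $\chi_d(G)$ is the smallest such $k$. -}

module Defs where

open import Data.Nat using (ℕ; zero; suc; _+_; _*_; _≤_)
open import Data.Fin using (Fin; toℕ)
open import Data.List using (List)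
open import Data.List.Membership.Propositional using (_∈_)
open import Data.Product using (Σ; ∃; _×_)
open import Data.Sum using (_⊎_)
open import Relation.Binary.PropositionalEquality using (_≡_; _≢_)
open import Relation.Nullary using (¬_)

Rel : ℕ → Set₁
Rel n = Fin n → Fin n → Set

ModEq : ℕ → ℕ → ℕ → Set
ModEq n a b = ∃ λ q₁ → ∃ λ q₂ → a + q₁ * n ≡ b + q₂ * n

Circulant : (n : ℕ) → List ℕ → Rel n
Circulant n S i j =
  Σ ℕ λ s → s ∈ S × (ModEq n (toℕ i + s) (toℕ j) ⊎ ModEq n (toℕ j + s) (toℕ i))

data Walk {n : ℕ} (G : Rel n) : Fin n → Fin n → ℕ → Set where
  stay : ∀ {u} → Walk G u u 0
  step : ∀ {u w v k} → G u w → Walk G w v k → Walk G u v (suc k)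

-- d_G(u,v) ≤ d  (some walk, hence some shortest path, of length ≤ d).
DistLE : {n : ℕ} → Rel n → ℕ → Fin n → Fin n → Set
DistLE G d u v = ∃ λ k → k ≤ d × Walk G u v k

IsDistColoring : {n : ℕ} → Rel n → (d k : ℕ) → (Fin n → Fin k) → Set
IsDistColoring G d k f =
  ∀ u v → u ≢ v → f u ≡ f v → ¬ DistLE G d u v

HasDistColoring : {n : ℕ} → Rel n → (d k : ℕ) → Set
HasDistColoring {n} G d k = Σ (Fin n → Fin k) (IsDistColoring G d k)

ChiDistEq : {n : ℕ} → Rel n → (d k : ℕ) → Set
ChiDistEq G d k = HasDistColoring G d k × (∀ k' → HasDistColoring G d k' → k ≤ k')

-- Colour vertex i by i mod (3d+1). Every jump has length at most 3, so a walk of length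
-- at most d gives u + P ≡ v + Q (mod n) with P + Q ≤ 3d < 3d+1. If u and v have the same
-- colour they are congruent modulo 3d+1, which divides n, so P = Q and then u = v.
-- Conversely the vertices 0, …, 3d are pairwise at distance at most d (an offset δ ≥ 2 is
-- covered by ⌈δ/3⌉ forward jumps, an offset 1 by +3−2 or −2+3), so by pigeonhole no
-- d-distance colouring uses fewer than 3d+1 colours.
module Submission where

open import Defs
open import Data.Nat using (ℕ; zero; suc; _+_; _*_; _∸_; _≤_; _<_; _%_; _/_; z≤n; s≤s; s≤s⁻¹; NonZero)
open import Data.Nat.Properties
open import Data.Nat.DivMod using (_mod_; m≡m%n+[m/n]*n; [m+kn]%n≡m%n; m<n⇒m%n≡m)
open import Algebra.Properties.CommutativeSemigroup +-commutativeSemigroup using (xy∙z≈xz∙y; xy∙z≈x∙zy; x∙yz≈y∙xz)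
open import Data.Fin as Fin using (Fin; toℕ; fromℕ<; inject≤)
open import Data.Fin.Properties
  using (toℕ<n; toℕ-injective; toℕ-fromℕ<; toℕ-inject≤; inject≤-injective; pigeonhole)
open import Data.List using (List; _∷_; [])
open import Data.List.Membership.Propositional using (_∈_)
open import Data.List.Relation.Unary.Any using (here; there)
open import Data.Product using (Σ; ∃₂; _×_; _,_)
open import Data.Sum using (inj₁; inj₂)
open import Function using (_∘_)
open import Function.Definitions using (Injective)
open import Level using (0ℓ)
open import Relation.Binary.Bundles using (Setoid)
open import Relation.Binary.Structures using (IsEquivalence)
open import Relation.Binary.PropositionalEquality
import Relation.Binary.Reasoning.Setoid as SetoidReasoning
open import Relation.Nullary using (yes; no; contradiction)

module _ {n : ℕ} where

  ModEq-reflexive : ∀ {a b} → a ≡ b → ModEq n a b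
  ModEq-reflexive a≡b = 0 , 0 , cong (_+ 0) a≡b

  ModEq-sym : ∀ {a b} → ModEq n a b → ModEq n b a
  ModEq-sym (x , y , e) = y , x , sym e

  ModEq-trans : ∀ {a b c} → ModEq n a b → ModEq n b c → ModEq n a c
  ModEq-trans {a} {b} {c} (x₁ , y₁ , e₁) (x₂ , y₂ , e₂) = x₁ + x₂ , y₂ + y₁ , (begin
    a + (x₁ + x₂) * n      ≡⟨ +-*-split a x₁ x₂ ⟩
    a + x₁ * n + x₂ * n    ≡⟨ cong (_+ x₂ * n) e₁ ⟩
    b + y₁ * n + x₂ * n    ≡⟨ xy∙z≈xz∙y b _ _ ⟩
    b + x₂ * n + y₁ * n    ≡⟨ cong (_+ y₁ * n) e₂ ⟩
    c + y₂ * n + y₁ * n    ≡⟨ +-*-split c y₂ y₁ ⟨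
    c + (y₂ + y₁) * n      ∎)
    where
    open ≡-Reasoning
    +-*-split : ∀ a x y → a + (x + y) * n ≡ a + x * n + y * n
    +-*-split a x y = trans (cong (a +_) (*-distribʳ-+ n x y)) (sym (+-assoc a _ _))

  ModEq-isEquivalence : IsEquivalence (ModEq n)
  ModEq-isEquivalence = record
    { refl = ModEq-reflexive refl ; sym = ModEq-sym ; trans = ModEq-trans }

  ModEq-+ʳ : ∀ {a b} k → ModEq n a b → ModEq n (a + k) (b + k)
  ModEq-+ʳ {a} {b} k (x , y , e) =
    x , y , trans (xy∙z≈xz∙y a k _) (trans (cong (_+ k) e) (xy∙z≈xz∙y b _ k))

  ModEq-cancelˡ : ∀ k {a b} → ModEq n (k + a) (k + b) → ModEq n a b
  ModEq-cancelˡ k {a} {b} (x , y , e) =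
    x , y , +-cancelˡ-≡ k _ _ (trans (sym (+-assoc k a _)) (trans e (+-assoc k b _)))

  ModEq-cancelʳ : ∀ k {a b} → ModEq n (a + k) (b + k) → ModEq n a b
  ModEq-cancelʳ k {a} {b} e = ModEq-cancelˡ k
    (ModEq-trans (ModEq-reflexive (+-comm k a)) (ModEq-trans e (ModEq-reflexive (+-comm b k))))

  ModEq⇒%≡ : ∀ .{{_ : NonZero n}} {a b} → ModEq n a b → a % n ≡ b % n
  ModEq⇒%≡ {a} {b} (x , y , e) = begin
    a % n            ≡⟨ [m+kn]%n≡m%n a x n ⟨
    (a + x * n) % n  ≡⟨ cong (_% n) e ⟩
    (b + y * n) % n  ≡⟨ [m+kn]%n≡m%n b y n ⟩
    b % n            ∎
    where open ≡-Reasoning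

  %≡⇒ModEq : ∀ .{{_ : NonZero n}} {a b} → a % n ≡ b % n → ModEq n a b
  %≡⇒ModEq {a} {b} e = b / n , a / n , (begin
    a + b / n * n                    ≡⟨ cong (_+ b / n * n) (m≡m%n+[m/n]*n a n) ⟩
    a % n + a / n * n + b / n * n    ≡⟨ cong (λ r → r + a / n * n + b / n * n) e ⟩
    b % n + a / n * n + b / n * n    ≡⟨ xy∙z≈xz∙y (b % n) _ _ ⟩
    b % n + b / n * n + a / n * n    ≡⟨ cong (_+ a / n * n) (m≡m%n+[m/n]*n b n) ⟨
    b + a / n * n                    ∎)
    where open ≡-Reasoning

ModEq-setoid : ℕ → Setoid 0ℓ 0ℓ
ModEq-setoid n = record { Carrier = ℕ ; _≈_ = ModEq n ; isEquivalence = ModEq-isEquivalence }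

ModEq-<⇒≡ : ∀ {n a b} → a < n → b < n → ModEq n a b → a ≡ b
ModEq-<⇒≡ {suc n} {a} {b} a<n b<n e = begin
  a            ≡⟨ m<n⇒m%n≡m a<n ⟨
  a % suc n    ≡⟨ ModEq⇒%≡ e ⟩
  b % suc n    ≡⟨ m<n⇒m%n≡m b<n ⟩
  b            ∎
  where open ≡-Reasoning

ModEq-*ʳ⇒ModEq : ∀ {N M a b} → ModEq (N * M) a b → ModEq N a b
ModEq-*ʳ⇒ModEq {N} {M} {a} {b} (x , y , e) =
  x * M , y * M , trans (cong (a +_) (reassoc x)) (trans e (cong (b +_) (sym (reassoc y))))
  where
  reassoc : ∀ q → q * M * N ≡ q * (N * M)
  reassoc q = trans (*-assoc q M N) (cong (q *_) (*-comm M N))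

module _ {n c : ℕ} {S : List ℕ} (S≤c : ∀ {s} → s ∈ S → s ≤ c) where
  open SetoidReasoning (ModEq-setoid n)

  step-bound : ∀ k {s m} → s ∈ S → m ≤ k * c → s + m ≤ suc k * c
  step-bound k s∈S = +-mono-≤ (S≤c s∈S)

  walk-displacement : ∀ {u v k} → Walk (Circulant n S) u v k →
    ∃₂ λ P Q → P + Q ≤ k * c × ModEq n (toℕ u + P) (toℕ v + Q)
  walk-displacement stay = 0 , 0 , z≤n , ModEq-reflexive refl
  walk-displacement {u} {v} (step {w = w} {k = k} (s , s∈S , u~w) w⇝v) with walk-displacement w⇝v
  ... | P , Q , P+Q≤kc , wP≡vQ with u~w
  ...   | inj₁ u+s≡w =
    s + P , Q , ≤-trans (≤-reflexive (+-assoc s P Q)) (step-bound k s∈S P+Q≤kc) , (begin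
      toℕ u + (s + P)  ≡⟨ +-assoc (toℕ u) s P ⟨
      toℕ u + s + P    ≈⟨ ModEq-+ʳ P u+s≡w ⟩
      toℕ w + P        ≈⟨ wP≡vQ ⟩
      toℕ v + Q        ∎)
  ...   | inj₂ w+s≡u =
    P , s + Q , ≤-trans (≤-reflexive (x∙yz≈y∙xz P s Q)) (step-bound k s∈S P+Q≤kc) , (begin
      toℕ u + P        ≈⟨ ModEq-+ʳ P w+s≡u ⟨
      toℕ w + s + P    ≡⟨ xy∙z≈xz∙y (toℕ w) s P ⟩
      toℕ w + P + s    ≈⟨ ModEq-+ʳ s wP≡vQ ⟩
      toℕ v + Q + s    ≡⟨ xy∙z≈x∙zy (toℕ v) Q s ⟩
      toℕ v + (s + Q)  ∎)

mod-isDistColoring : ∀ {S c d} N M .{{_ : NonZero N}} → (∀ {s} → s ∈ S → s ≤ c) → d * c < N →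
  IsDistColoring (Circulant (N * M) S) d N (λ i → toℕ i mod N)
mod-isDistColoring {S} {c} {d} N M S≤c dc<N u v u≢v same-colour (k , k≤d , u⇝v)
  with walk-displacement S≤c u⇝v
... | P , Q , P+Q≤kc , uP≡vQ = u≢v (toℕ-injective (ModEq-<⇒≡ (toℕ<n u) (toℕ<n v) u≡v))
  where
  P+Q<N : P + Q < N
  P+Q<N = ≤-<-trans P+Q≤kc (≤-<-trans (*-monoˡ-≤ c k≤d) dc<N)
  u≡v[N] : ModEq N (toℕ u) (toℕ v)
  u≡v[N] = %≡⇒ModEq (trans (sym (toℕ-fromℕ< _)) (trans (cong toℕ same-colour) (toℕ-fromℕ< _)))
  P≡Q : P ≡ Q
  P≡Q = ModEq-<⇒≡ (≤-<-trans (m≤m+n P Q) P+Q<N) (≤-<-trans (m≤n+m Q P) P+Q<N)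
    (ModEq-cancelˡ (toℕ v) (begin
      toℕ v + P  ≈⟨ ModEq-+ʳ P u≡v[N] ⟨
      toℕ u + P  ≈⟨ ModEq-*ʳ⇒ModEq uP≡vQ ⟩
      toℕ v + Q  ∎))
    where open SetoidReasoning (ModEq-setoid N)
  u≡v : ModEq (N * M) (toℕ u) (toℕ v)
  u≡v = ModEq-cancelʳ P (subst (λ q → ModEq (N * M) (toℕ u + P) (toℕ v + q)) (sym P≡Q) uP≡vQ)

clique≤colours : ∀ {n N k d} {G : Rel n} (e : Fin N → Fin n) → Injective _≡_ _≡_ e →
  (∀ {i j} → i Fin.< j → DistLE G d (e i) (e j)) → HasDistColoring G d k → N ≤ k
clique≤colours {N = N} {k} e e-injective e-close (f , f-colouring) with N ≤? k
... | yes N≤k = N≤k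
... | no N≰k with pigeonhole (≰⇒> N≰k) (f ∘ e)
...   | i , j , i<j , same-colour =
  contradiction (e-close i<j) (f-colouring (e i) (e j) (<⇒≢ i<j ∘ cong toℕ ∘ e-injective) same-colour)

DistLE-step : ∀ {n d} {G : Rel n} {u w v} → G u w → DistLE G d w v → DistLE G (suc d) u v
DistLE-step u~w (k , k≤d , w⇝v) = suc k , s≤s k≤d , step u~w w⇝v

module _ {n : ℕ} {S : List ℕ} where

  edge-up : ∀ {s} {u w : Fin n} → s ∈ S → toℕ w ≡ toℕ u + s → Circulant n S u w
  edge-up {s} s∈S w≡u+s = s , s∈S , inj₁ (ModEq-reflexive (sym w≡u+s))

  edge-down : ∀ {s} {u w : Fin n} → s ∈ S → toℕ u ≡ toℕ w + s → Circulant n S u w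
  edge-down {s} s∈S u≡w+s = s , s∈S , inj₂ (ModEq-reflexive (sym u≡w+s))

  edge-up-within : ∀ {s δ} {u v : Fin n} → s ∈ S → toℕ v ≡ toℕ u + (s + δ) →
    Σ (Fin n) λ w → Circulant n S u w × toℕ v ≡ toℕ w + δ
  edge-up-within {s} {δ} {u} {v} s∈S v≡u+s+δ = w , edge-up s∈S w≡u+s , v≡w+δ
    where
    u+s<n : toℕ u + s < n
    u+s<n = ≤-<-trans (≤-trans (+-monoʳ-≤ (toℕ u) (m≤m+n s δ)) (≤-reflexive (sym v≡u+s+δ))) (toℕ<n v)
    w : Fin n
    w = fromℕ< u+s<n
    w≡u+s : toℕ w ≡ toℕ u + s
    w≡u+s = toℕ-fromℕ< u+s<n
    v≡w+δ : toℕ v ≡ toℕ w + δ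
    v≡w+δ = trans v≡u+s+δ (trans (sym (+-assoc (toℕ u) s δ)) (cong (_+ δ) (sym w≡u+s)))

module _ {n : ℕ} where
  private
    C : Rel n
    C = Circulant n (2 ∷ 3 ∷ [])

    2∈ : 2 ∈ 2 ∷ 3 ∷ []
    2∈ = here refl

    3∈ : 3 ∈ 2 ∷ 3 ∷ []
    3∈ = there (here refl)

  -- Bounds are written d * 3 so that suc d * 3 unfolds to 3 + d * 3.
  offset≥2⇒DistLE : ∀ d t {u v : Fin n} → suc (suc t) ≤ d * 3 →
    toℕ v ≡ toℕ u + suc (suc t) → DistLE C d u v
  offset≥2⇒DistLE zero t () _
  offset≥2⇒DistLE (suc d) 0 _ v≡u+2 = DistLE-step (edge-up 2∈ v≡u+2) (0 , z≤n , stay)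
  offset≥2⇒DistLE (suc d) 1 _ v≡u+3 = DistLE-step (edge-up 3∈ v≡u+3) (0 , z≤n , stay)
  offset≥2⇒DistLE (suc zero) 2 (s≤s (s≤s (s≤s ()))) _
  offset≥2⇒DistLE (suc (suc d)) 2 _ v≡u+4 with edge-up-within 2∈ v≡u+4
  ... | w , u~w , v≡w+2 = DistLE-step u~w (offset≥2⇒DistLE (suc d) 0 (s≤s (s≤s z≤n)) v≡w+2)
  offset≥2⇒DistLE (suc d) (suc (suc (suc t))) 5+t≤ v≡u+5+t with edge-up-within 3∈ v≡u+5+t
  ... | w , u~w , v≡w+2+t =
    DistLE-step u~w (offset≥2⇒DistLE d t (s≤s⁻¹ (s≤s⁻¹ (s≤s⁻¹ 5+t≤))) v≡w+2+t)

  up3-down2 : ∀ {u v : Fin n} → toℕ u + 3 < n → toℕ v ≡ toℕ u + 1 → Walk C u v 2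
  up3-down2 {u} {v} u+3<n v≡u+1 = step (edge-up 3∈ w≡u+3) (step (edge-down 2∈ w≡v+2) stay)
    where
    w : Fin n
    w = fromℕ< u+3<n
    w≡u+3 : toℕ w ≡ toℕ u + 3
    w≡u+3 = toℕ-fromℕ< u+3<n
    w≡v+2 : toℕ w ≡ toℕ v + 2
    w≡v+2 = trans w≡u+3 (trans (sym (+-assoc (toℕ u) 1 2)) (cong (_+ 2) (sym v≡u+1)))

  down2-up3 : ∀ {u v : Fin n} → 2 ≤ toℕ u → toℕ v ≡ toℕ u + 1 → Walk C u v 2
  down2-up3 {u} {v} 2≤u v≡u+1 = step (edge-down 2∈ u≡w+2) (step (edge-up 3∈ v≡w+3) stay)
    where
    w : Fin n
    w = fromℕ< (≤-<-trans (m∸n≤m (toℕ u) 2) (toℕ<n u))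
    u≡w+2 : toℕ u ≡ toℕ w + 2
    u≡w+2 = trans (sym (m∸n+n≡m 2≤u)) (cong (_+ 2) (sym (toℕ-fromℕ< _)))
    v≡w+3 : toℕ v ≡ toℕ w + 3
    v≡w+3 = trans v≡u+1 (trans (cong (_+ 1) u≡w+2) (+-assoc (toℕ w) 2 1))

  offset1⇒Walk : ∀ {u v : Fin n} → 5 ≤ n → toℕ v ≡ toℕ u + 1 → Walk C u v 2
  offset1⇒Walk {u} 5≤n v≡u+1 with 2 ≤? toℕ u
  ... | yes 2≤u = down2-up3 2≤u v≡u+1
  ... | no 2≰u = up3-down2 (≤-trans (+-monoˡ-≤ 3 (≰⇒> 2≰u)) 5≤n) v≡u+1

  offset⇒DistLE : ∀ d δ {u v : Fin n} → 5 ≤ n → 2 ≤ d → suc δ ≤ d * 3 →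
    toℕ v ≡ toℕ u + suc δ → DistLE C d u v
  offset⇒DistLE d zero 5≤n 2≤d _ v≡u+1 = 2 , 2≤d , offset1⇒Walk 5≤n v≡u+1
  offset⇒DistLE d (suc t) _ _ δ≤ v≡u+δ = offset≥2⇒DistLE d t δ≤ v≡u+δ

  initial-segment-DistLE : ∀ d → 2 ≤ d → (N≤n : suc (d * 3) ≤ n) → ∀ {i j} → i Fin.< j →
    DistLE C d (inject≤ i N≤n) (inject≤ j N≤n)
  initial-segment-DistLE d 2≤d N≤n {i} {j} i<j = offset⇒DistLE d δ 5≤n 2≤d δ≤ (begin
    toℕ (inject≤ j N≤n)          ≡⟨ toℕ-inject≤ j N≤n ⟩
    toℕ j                        ≡⟨ j≡i+δ ⟩
    toℕ i + suc δ                ≡⟨ cong (_+ suc δ) (toℕ-inject≤ i N≤n) ⟨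
    toℕ (inject≤ i N≤n) + suc δ  ∎)
    where
    open ≡-Reasoning
    δ : ℕ
    δ = toℕ j ∸ suc (toℕ i)
    j≡i+δ : toℕ j ≡ toℕ i + suc δ
    j≡i+δ = trans (sym (m+[n∸m]≡n i<j)) (sym (+-suc (toℕ i) δ))
    δ≤ : suc δ ≤ d * 3
    δ≤ = ≤-trans (m≤n+m (suc δ) (toℕ i)) (≤-trans (≤-reflexive (sym j≡i+δ)) (s≤s⁻¹ (toℕ<n j)))
    5≤n : 5 ≤ n
    5≤n = ≤-trans (m≤m+n 5 2) (≤-trans (s≤s (*-monoˡ-≤ 3 2≤d)) N≤n)

jumps≤3 : ∀ {s} → s ∈ 2 ∷ 3 ∷ [] → s ≤ 3
jumps≤3 (here refl) = n≤1+n 2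
jumps≤3 (there (here refl)) = ≤-refl

corollary14 : (d m : ℕ) → 2 ≤ d → 1 ≤ m →
    ChiDistEq (Circulant ((3 * d + 1) * m) (2 ∷ 3 ∷ [])) d (3 * d + 1)
corollary14 d m@(suc _) 2≤d _ rewrite +-comm (3 * d) 1 | *-comm 3 d =
  (_ , mod-isDistColoring (suc (d * 3)) m jumps≤3 ≤-refl) ,
  λ _ → clique≤colours (λ i → inject≤ i N≤n) (inject≤-injective N≤n N≤n _ _)
                       (initial-segment-DistLE d 2≤d N≤n)
  where
  N≤n : suc (d * 3) ≤ suc (d * 3) * m
  N≤n = m≤m*n (suc (d * 3)) m
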